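{- Let $G^*$ be a non-trivial stem diagram with vertex set $R\sqcup B$, and let $r=|R|$, $m=|B|$, $\tau^*=\sum_{x\in R}(\deg_{G^*}(x)-1)$, and let $\chi(R)$ be the Euler characteristic (number of vertices minus number of edges) of the subgraph of $G^*$ induced on $R$. Then \[ \tau^*+2-r\le m\le \tau^*+1\qquad\text{and}\qquad \tau^*=|G^*|-1-\chi(R), \] where $|G^*|$ is the number of vertices of $G^*$. In particular $\tau^*\le|G^*|-2$, with equality if and only if the induced subgraph on $R$ is connected.
   Context: A stem diagram is a finite graph $G^*$ whose vertex set is partitioned as $V(G^*)=R\sqcup B$ (red and blue vertices) such that: (i) $G^*$ is a finite tree; (ii) no edge joins two vertices of $B$; (iii) every leaf of $G^*$ belongs to $B$. It is non-trivial if $R\neq\emptyset$. -}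

module Defs where

open import Data.Nat using (ℕ; zero; suc; _≤_; _<ᵇ_)
open import Data.Fin using (Fin; toℕ)
open import Data.Bool using (Bool; true; false; if_then_else_; _∧_; not)
open import Data.List using (List; []; _∷_; _∷ʳ_; map; allFin; length)
open import Data.Nat.ListAction using (sum)
open import Data.List.Relation.Unary.Linked using (Linked)
open import Data.List.Relation.Unary.Unique.Propositional using (Unique)
open import Data.Product using (Σ; ∃; _×_)
open import Data.Integer using (ℤ; +_; _+_; _-_)
open import Relation.Binary.PropositionalEquality using (_≡_)
open import Relation.Nullary using (¬_)

record Graph (n : ℕ) : Set where
  field
    adj   : Fin n → Fin n → Bool
    sym   : ∀ i j → adj i j ≡ adj j i
    irrefl : ∀ i → adj i i ≡ false
open Graph public

module _ {n : ℕ} (G : Graph n) where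

  Adj : Fin n → Fin n → Set
  Adj i j = adj G i j ≡ true

  data WalkIn (S : Fin n → Bool) : Fin n → Fin n → Set where
    here : ∀ {i} → S i ≡ true → WalkIn S i i
    step : ∀ {i j k} → S i ≡ true → Adj i j → WalkIn S j k → WalkIn S i k

  ConnectedOn : (Fin n → Bool) → Set
  ConnectedOn S = ∀ i j → S i ≡ true → S j ≡ true → WalkIn S i j

  Connected : Set
  Connected = ConnectedOn (λ _ → true)

  HasCycle : Set
  HasCycle = Σ (Fin n) λ v → Σ (Fin n) λ u → Σ (List (Fin n)) λ ws →
    Unique (v ∷ ws ∷ʳ u) × Linked Adj (v ∷ ws ∷ʳ u) × 1 ≤ length ws × Adj u v

  IsTree : Set
  IsTree = Fin n × Connected × ¬ HasCycle

  count : (Fin n → Bool) → ℕ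
  count p = sum (map (λ i → if p i then 1 else 0) (allFin n))

  degree : Fin n → ℕ
  degree i = count (adj G i)

  edgesIn : (Fin n → Bool) → ℕ
  edgesIn S = sum (map (λ i → count (λ j → adj G i j ∧ S i ∧ S j ∧ (toℕ i <ᵇ toℕ j))) (allFin n))

  χ : (Fin n → Bool) → ℤ
  χ S = + count S - + edgesIn S

  sumOver : (Fin n → Bool) → (Fin n → ℤ) → ℤ
  sumOver S f = go (allFin n)
    where
    go : List (Fin n) → ℤ
    go [] = + 0
    go (x ∷ xs) = (if S x then f x else + 0) + go xs

-- A stem diagram: a graph with a red/blue colouring (red x ≡ true means x ∈ R, otherwise x ∈ B)
record StemDiagram (n : ℕ) : Set where
  field
    graph : Graph n
    red   : Fin n → Bool
    tree  : IsTree graph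
    noBlueEdge : ∀ i j → red i ≡ false → red j ≡ false → ¬ Adj graph i j
    leavesBlue : ∀ i → degree graph i ≡ 1 → red i ≡ false
open StemDiagram public

NonTrivial : ∀ {n} → StemDiagram n → Set
NonTrivial D = ∃ λ x → red D x ≡ true

τ* : ∀ {n} → StemDiagram n → ℤ
τ* D = sumOver (graph D) (red D) (λ x → + degree (graph D) x - + 1)

{-# OPTIONS --safe #-}
module Submission where

-- Every edge of G* has a red endpoint, so Σ_{x ∈ R} deg x counts each edge of G* once and each
-- edge inside R once more: Σ_{x ∈ R} deg x = e(G*) + e(R) = (|G*| - 1) + e(R), whence
-- τ* = |G*| - 1 - (|R| - e(R)) = |G*| - 1 - χ(R).  The subgraph induced on R is a forest, so
-- χ(R) ≥ 1 with equality iff it is connected; this follows by induction on |R|, deleting a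
-- vertex of degree at most 1 in R, which exists at the end of a maximal path.  The bounds on
-- m = |G*| - r then amount to χ(R) ≥ 1 and e(R) ≥ 0.

module Forests where

  open import Defs renaming (sym to adj-sym)
  open import Data.Bool using (Bool; true; false; if_then_else_; _∧_; not)
  open import Data.Bool.Properties using (∧-identityʳ; ∧-zeroʳ; ¬-not)
  import Data.Bool.Properties as Bool
  open import Data.Empty using (⊥-elim)
  open import Data.Fin using (Fin; zero; suc; toℕ)
  open import Data.Fin.Properties using (_≟_; toℕ-injective; any?)
  open import Data.List using (List; []; _∷_; _++_; [_]; _∷ʳ_; length; take; map; tabulate; allFin)
  open import Data.List.Membership.Propositional using (_∈_)
  open import Data.List.Membership.Propositional.Properties using (∈-∃++)
  import Data.List.Membership.DecPropositional as DecMembership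
  open import Data.List.Properties using (++-assoc; length-take)
  open import Data.List.Relation.Unary.All as All using (All; []; _∷_)
  open import Data.List.Relation.Unary.All.Properties using (¬Any⇒All¬) renaming (++⁻ˡ to All-++⁻ˡ)
  open import Data.List.Relation.Unary.AllPairs using ([]; _∷_)
  open import Data.List.Relation.Unary.Any using (here; there)
  open import Data.List.Relation.Unary.Any.Properties using (¬Any[])
  open import Data.List.Relation.Unary.Linked using (Linked; []; [-]; _∷_)
  open import Data.List.Relation.Unary.Unique.Propositional using (Unique)
  open import Data.Nat using (ℕ; zero; suc; _+_; _≤_; z≤n; s≤s; _<ᵇ_)
  open import Data.Nat.ListAction using (sum)
  open import Data.Nat.Properties
    using (+-identityʳ; +-comm; +-suc; +-mono-≤; ≤-trans; ≤-reflexive; ≤-antisym; <⇒≤; <⇒≢; 1+n≰n;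
           m⊓n≤m; n≤0⇒n≡0; suc-injective; +-0-commutativeMonoid; module ≤-Reasoning)
  open import Algebra.Properties.CommutativeMonoid.Sum +-0-commutativeMonoid
    using (∑-distrib-+; ∑-comm; sum-cong-≗; sum-replicate-zero) renaming (sum to ∑)
  open import Data.Product using (∃; _×_; _,_; proj₁; proj₂)
  open import Data.Product.Function.NonDependent.Propositional using (_×-⇔_)
  open import Function using (id; _∘_)
  open import Function.Bundles using (_⇔_; mk⇔; Equivalence)
  open import Function.Properties.Equivalence using () renaming (refl to ⇔-refl; sym to ⇔-sym; trans to ⇔-trans)
  open import Relation.Binary.PropositionalEquality
    using (_≡_; _≢_; refl; sym; trans; cong; cong₂; subst; subst₂; module ≡-Reasoning)
  open import Relation.Nullary using (yes; no; does; ¬_)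
  open import Relation.Nullary.Decidable using (_×-dec_; ¬?; decidable-stable)

  ⟦_⟧ : Bool → ℕ
  ⟦ b ⟧ = if b then 1 else 0

  ∣_∣ : ∀ {n} → (Fin n → Bool) → ℕ
  ∣ p ∣ = ∑ (λ i → ⟦ p i ⟧)

  _∖_ : ∀ {n} → (Fin n → Bool) → Fin n → (Fin n → Bool)
  (p ∖ a) j = p j ∧ not (does (j ≟ a))

  ∑-zero : ∀ {n} {f : Fin n → ℕ} → (∀ i → f i ≡ 0) → ∑ f ≡ 0
  ∑-zero {n} f≗0 = trans (sum-cong-≗ f≗0) (sum-replicate-zero n)

  ∑-δ : ∀ {n} (a : Fin n) (f : Fin n → ℕ) → ∑ (λ i → if does (i ≟ a) then f i else 0) ≡ f a
  ∑-δ {suc n} zero    f = trans (cong (f zero +_) (∑-zero {n} λ _ → refl)) (+-identityʳ (f zero))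
  ∑-δ         (suc a) f = ∑-δ a (f ∘ suc)

  ∑²-distrib-+ : ∀ {m n} (f g : Fin m → Fin n → ℕ) →
                 ∑ (λ i → ∑ (λ j → f i j + g i j)) ≡ ∑ (λ i → ∑ (f i)) + ∑ (λ i → ∑ (g i))
  ∑²-distrib-+ f g =
    trans (sum-cong-≗ (λ i → ∑-distrib-+ (f i) (g i))) (∑-distrib-+ (λ i → ∑ (f i)) (λ i → ∑ (g i)))

  sum-map-tabulate : ∀ {A : Set} {n} (f : A → ℕ) (g : Fin n → A) → sum (map f (tabulate g)) ≡ ∑ (f ∘ g)
  sum-map-tabulate {n = zero}  f g = refl
  sum-map-tabulate {n = suc n} f g = cong (f (g zero) +_) (sum-map-tabulate f (g ∘ suc))

  ∖⁺ : ∀ {n} {p : Fin n → Bool} {a j} → p j ≡ true → j ≢ a → (p ∖ a) j ≡ true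
  ∖⁺ {a = a} {j} pj j≢a with j ≟ a
  ... | yes j≡a = ⊥-elim (j≢a j≡a)
  ... | no _    rewrite pj = refl

  ∖⁻ : ∀ {n} {p : Fin n → Bool} {a j} → (p ∖ a) j ≡ true → p j ≡ true
  ∖⁻ {p = p} {a} {j} _ with p j | j ≟ a
  ∖⁻ refl | true | no _ = refl

  ∖-≢ : ∀ {n} {p : Fin n → Bool} {a j} → (p ∖ a) j ≡ true → j ≢ a
  ∖-≢ {p = p} {a} {j} _ with p j | j ≟ a
  ∖-≢ refl | true | no j≢a = j≢a

  ∣∣-split : ∀ {n} (p : Fin n → Bool) (a : Fin n) → ∣ p ∣ ≡ ⟦ p a ⟧ + ∣ p ∖ a ∣
  ∣∣-split p a = begin
      ∣ p ∣
    ≡⟨ sum-cong-≗ pointwise ⟩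
      ∑ (λ j → (if does (j ≟ a) then ⟦ p j ⟧ else 0) + ⟦ (p ∖ a) j ⟧)
    ≡⟨ ∑-distrib-+ (λ j → if does (j ≟ a) then ⟦ p j ⟧ else 0) (λ j → ⟦ (p ∖ a) j ⟧) ⟩
      ∑ (λ j → if does (j ≟ a) then ⟦ p j ⟧ else 0) + ∣ p ∖ a ∣
    ≡⟨ cong (_+ ∣ p ∖ a ∣) (∑-δ a (λ j → ⟦ p j ⟧)) ⟩
      ⟦ p a ⟧ + ∣ p ∖ a ∣
    ∎
    where
    open ≡-Reasoning
    pointwise : ∀ j → ⟦ p j ⟧ ≡ (if does (j ≟ a) then ⟦ p j ⟧ else 0) + ⟦ (p ∖ a) j ⟧
    pointwise j with j ≟ a
    ... | yes _ rewrite ∧-zeroʳ (p j)     = sym (+-identityʳ _)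
    ... | no _  rewrite ∧-identityʳ (p j) = refl

  ∣∣-∖ : ∀ {n} {p : Fin n → Bool} {a} → p a ≡ true → ∣ p ∣ ≡ suc ∣ p ∖ a ∣
  ∣∣-∖ {p = p} {a} pa = subst (λ b → ∣ p ∣ ≡ ⟦ b ⟧ + ∣ p ∖ a ∣) pa (∣∣-split p a)

  ∣∣>0 : ∀ {n} {p : Fin n → Bool} {a} → p a ≡ true → 1 ≤ ∣ p ∣
  ∣∣>0 {p = p} pa = subst (1 ≤_) (sym (∣∣-∖ {p = p} pa)) (s≤s z≤n)

  ∣∣>0⇒∃ : ∀ {n} (p : Fin n → Bool) → 1 ≤ ∣ p ∣ → ∃ λ i → p i ≡ true
  ∣∣>0⇒∃ {suc n} p ∣p∣>0 with p zero in p0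
  ... | true  = zero , p0
  ... | false with i , pi ← ∣∣>0⇒∃ (p ∘ suc) ∣p∣>0 = suc i , pi

  ∣∣≡0⇒∅ : ∀ {n} (p : Fin n → Bool) → ∣ p ∣ ≡ 0 → ∀ j → p j ≡ false
  ∣∣≡0⇒∅ p ∣p∣≡0 j = ¬-not λ pj → 1+n≰n (subst (1 ≤_) ∣p∣≡0 (∣∣>0 {p = p} pj))

  ∣∣-mono : ∀ {n} {p q : Fin n → Bool} → (∀ j → p j ≡ true → q j ≡ true) → ∣ p ∣ ≤ ∣ q ∣
  ∣∣-mono {zero}  p⊆q = z≤n
  ∣∣-mono {suc n} p⊆q = +-mono-≤ (⟦⟧-mono (p⊆q zero)) (∣∣-mono (p⊆q ∘ suc))
    where
    ⟦⟧-mono : ∀ {a b} → (a ≡ true → b ≡ true) → ⟦ a ⟧ ≤ ⟦ b ⟧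
    ⟦⟧-mono {false}        _   = z≤n
    ⟦⟧-mono {true} {true}  _   = s≤s z≤n
    ⟦⟧-mono {true} {false} a⇒b with () ← a⇒b refl

  ∣∣≤length : ∀ {n} {p : Fin n → Bool} (l : List (Fin n)) → (∀ j → p j ≡ true → j ∈ l) → ∣ p ∣ ≤ length l
  ∣∣≤length [] p⊆[] = ≤-reflexive (∑-zero λ j → cong ⟦_⟧ (¬-not λ pj → ¬Any[] (p⊆[] j pj)))
  ∣∣≤length {p = p} (y ∷ ys) p⊆y∷ys = begin
      ∣ p ∣                  ≡⟨ ∣∣-split p y ⟩
      ⟦ p y ⟧ + ∣ p ∖ y ∣    ≤⟨ +-mono-≤ (⟦⟧≤1 (p y)) (∣∣≤length ys p∖y⊆ys) ⟩
      suc (length ys)        ∎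
    where
    open ≤-Reasoning
    ⟦⟧≤1 : ∀ b → ⟦ b ⟧ ≤ 1
    ⟦⟧≤1 true  = s≤s z≤n
    ⟦⟧≤1 false = z≤n
    p∖y⊆ys : ∀ j → (p ∖ y) j ≡ true → j ∈ ys
    p∖y⊆ys j pj with p⊆y∷ys j (∖⁻ {p = p} pj)
    ... | here j≡y   = ⊥-elim (∖-≢ {p = p} pj j≡y)
    ... | there j∈ys = j∈ys

  length≤∣∣ : ∀ {n} {p : Fin n → Bool} {l : List (Fin n)} →
              Unique l → All (λ j → p j ≡ true) l → length l ≤ ∣ p ∣
  length≤∣∣ [] [] = z≤n
  length≤∣∣ {p = p} (x∉l ∷ unique) (px ∷ pl) =
    ≤-trans (s≤s (length≤∣∣ unique (All.zipWith (λ (py , x≢y) → ∖⁺ {p = p} py (x≢y ∘ sym)) (pl , x∉l))))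
            (≤-reflexive (sym (∣∣-∖ {p = p} px)))

  ∣∣≤1⇒unique : ∀ {n} {p : Fin n → Bool} {a b} → ∣ p ∣ ≤ 1 → p a ≡ true → p b ≡ true → a ≡ b
  ∣∣≤1⇒unique {p = p} {a} {b} ∣p∣≤1 pa pb with b ≟ a
  ... | yes b≡a = sym b≡a
  ... | no b≢a
    with s≤s () ← subst (_≤ 1) (trans (∣∣-∖ {p = p} pa) (cong suc (∣∣-∖ {p = p ∖ a} (∖⁺ {p = p} pb b≢a)))) ∣p∣≤1

  ∣full∣≡n : ∀ {n} → ∣ (λ (_ : Fin n) → true) ∣ ≡ n
  ∣full∣≡n {zero}  = refl
  ∣full∣≡n {suc n} = cong suc (∣full∣≡n {n})

  ∣∣+∣not∣≡n : ∀ {n} (p : Fin n → Bool) → ∣ p ∣ + ∣ not ∘ p ∣ ≡ n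
  ∣∣+∣not∣≡n {n} p = begin
      ∣ p ∣ + ∣ not ∘ p ∣                ≡⟨ ∑-distrib-+ (λ i → ⟦ p i ⟧) (λ i → ⟦ not (p i) ⟧) ⟨
      ∑ (λ i → ⟦ p i ⟧ + ⟦ not (p i) ⟧)  ≡⟨ sum-cong-≗ (λ i → ⟦b⟧+⟦not-b⟧≡1 (p i)) ⟩
      ∣ (λ (_ : Fin n) → true) ∣         ≡⟨ ∣full∣≡n ⟩
      n                                  ∎
    where
    open ≡-Reasoning
    ⟦b⟧+⟦not-b⟧≡1 : ∀ b → ⟦ b ⟧ + ⟦ not b ⟧ ≡ 1
    ⟦b⟧+⟦not-b⟧≡1 true  = refl
    ⟦b⟧+⟦not-b⟧≡1 false = refl

  ∧-true⁻ : ∀ a {b} → a ∧ b ≡ true → a ≡ true × b ≡ true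
  ∧-true⁻ true b≡true = refl , b≡true

  Unique-++⁻ˡ : ∀ {A : Set} (xs : List A) {ys} → Unique (xs ++ ys) → Unique xs
  Unique-++⁻ˡ []       _                   = []
  Unique-++⁻ˡ (x ∷ xs) (x∉xs++ys ∷ unique) = All-++⁻ˡ xs x∉xs++ys ∷ Unique-++⁻ˡ xs unique

  Linked-++⁻ˡ : ∀ {A : Set} {R : A → A → Set} (xs : List A) {ys} → Linked R (xs ++ ys) → Linked R xs
  Linked-++⁻ˡ []           _              = []
  Linked-++⁻ˡ (x ∷ [])     _              = [-]
  Linked-++⁻ˡ (x ∷ y ∷ xs) (x~y ∷ linked) = x~y ∷ Linked-++⁻ˡ (y ∷ xs) linked

  <ᵇ-antisym : ∀ {a b} → a ≢ b → (a <ᵇ b) ≡ not (b <ᵇ a)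
  <ᵇ-antisym {zero}  {zero}  a≢b = ⊥-elim (a≢b refl)
  <ᵇ-antisym {zero}  {suc b} _   = refl
  <ᵇ-antisym {suc a} {zero}  _   = refl
  <ᵇ-antisym {suc a} {suc b} a≢b = <ᵇ-antisym (a≢b ∘ cong suc)

  leaf-count-arithmetic : ∀ {E e d N c : ℕ} → E ≡ e + d → N ≡ suc c → d ≤ 1 → suc e ≤ c →
                          suc E ≤ N × (suc E ≡ N ⇔ (d ≡ 1 × suc e ≡ c))
  leaf-count-arithmetic {e = e} refl refl z≤n e<c =
    s≤s (≤-trans (≤-reflexive (+-identityʳ e)) (<⇒≤ e<c)) ,
    mk⇔ (λ e+0≡c → ⊥-elim (<⇒≢ e<c (trans (sym (+-identityʳ e)) (suc-injective e+0≡c)))) (λ ())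
  leaf-count-arithmetic {e = e} {c = c} refl refl (s≤s z≤n) e<c =
    s≤s (subst (_≤ c) (+-comm 1 e) e<c) ,
    mk⇔ (λ e+1≡c → refl , trans (+-comm 1 e) (suc-injective e+1≡c))
        (λ (_ , 1+e≡c) → cong suc (trans (+-comm e 1) 1+e≡c))

  module _ {n : ℕ} (G : Graph n) where

    before : Fin n → Fin n → Bool
    before i j = toℕ i <ᵇ toℕ j

    edges : (Fin n → Bool) → ℕ
    edges S = ∑ (λ i → ∣ (λ j → adj G i j ∧ S i ∧ S j ∧ before i j) ∣)

    degreeIn : (Fin n → Bool) → Fin n → ℕ
    degreeIn S v = ∣ (λ j → adj G v j ∧ S j) ∣

    IsVertexCover : (Fin n → Bool) → Set
    IsVertexCover R = ∀ i j → R i ≡ false → R j ≡ false → ¬ Adj G i j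

    Adj⇒≢ : ∀ {i j} → Adj G i j → i ≢ j
    Adj⇒≢ {i} i~i refl with () ← trans (sym (irrefl G i)) i~i

    before-antisym : ∀ {i j} → Adj G i j → before i j ≡ not (before j i)
    before-antisym i~j = <ᵇ-antisym (λ i≡j → Adj⇒≢ i~j (toℕ-injective i≡j))

    split-by-orientation : ∀ i j b →
      ⟦ adj G i j ∧ b ⟧ ≡ ⟦ adj G i j ∧ b ∧ before i j ⟧ + ⟦ adj G i j ∧ b ∧ before j i ⟧
    split-by-orientation i j b with adj G i j in i~j
    ... | false = refl
    ... | true rewrite before-antisym i~j = split b (before j i)
      where
      split : ∀ b x → ⟦ b ⟧ ≡ ⟦ b ∧ not x ⟧ + ⟦ b ∧ x ⟧
      split false _     = refl
      split true  false = refl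
      split true  true  = refl

    degreeIn-by-orientation : ∀ S v → degreeIn S v ≡
      ∑ (λ j → ⟦ adj G v j ∧ S j ∧ before v j ⟧) + ∑ (λ i → ⟦ adj G i v ∧ S i ∧ before i v ⟧)
    degreeIn-by-orientation S v = begin
        degreeIn S v
      ≡⟨ sum-cong-≗ (λ j → split-by-orientation v j (S j)) ⟩
        ∑ (λ j → ⟦ adj G v j ∧ S j ∧ before v j ⟧ + ⟦ adj G v j ∧ S j ∧ before j v ⟧)
      ≡⟨ sum-cong-≗ (λ j → cong (λ a → ⟦ adj G v j ∧ S j ∧ before v j ⟧ + ⟦ a ∧ S j ∧ before j v ⟧)
                                (adj-sym G v j)) ⟩
        ∑ (λ j → ⟦ adj G v j ∧ S j ∧ before v j ⟧ + ⟦ adj G j v ∧ S j ∧ before j v ⟧)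
      ≡⟨ ∑-distrib-+ (λ j → ⟦ adj G v j ∧ S j ∧ before v j ⟧) (λ j → ⟦ adj G j v ∧ S j ∧ before j v ⟧) ⟩
        ∑ (λ j → ⟦ adj G v j ∧ S j ∧ before v j ⟧) + ∑ (λ i → ⟦ adj G i v ∧ S i ∧ before i v ⟧)
      ∎
      where open ≡-Reasoning

    -- An edge inside S either avoids v or has v as its first or as its second endpoint.
    edge-indicator-∖ : ∀ {S v} → S v ≡ true → ∀ i j →
      ⟦ adj G i j ∧ S i ∧ S j ∧ before i j ⟧ ≡
        ⟦ adj G i j ∧ (S ∖ v) i ∧ (S ∖ v) j ∧ before i j ⟧
        + ((if does (i ≟ v) then ⟦ adj G i j ∧ S j ∧ before i j ⟧ else 0)
        +  (if does (j ≟ v) then ⟦ adj G i j ∧ S i ∧ before i j ⟧ else 0))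
    edge-indicator-∖ {S} {v} Sv i j with i ≟ v | j ≟ v
    ... | yes refl | yes refl rewrite irrefl G v = refl
    ... | yes refl | no _     rewrite Sv | ∧-zeroʳ (adj G v j) = sym (+-identityʳ _)
    ... | no _     | yes refl rewrite Sv | ∧-identityʳ (S i) | ∧-zeroʳ (S i) | ∧-zeroʳ (adj G i v) = refl
    ... | no _     | no _     rewrite ∧-identityʳ (S i) | ∧-identityʳ (S j) = sym (+-identityʳ _)

    edges-∖ : ∀ {S v} → S v ≡ true → edges S ≡ edges (S ∖ v) + degreeIn S v
    edges-∖ {S} {v} Sv = begin
        edges S
      ≡⟨ sum-cong-≗ (λ i → sum-cong-≗ (edge-indicator-∖ Sv i)) ⟩
        ∑ (λ i → ∑ (λ j → inside i j + (from-v i j + to-v i j)))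
      ≡⟨ ∑²-distrib-+ inside (λ i j → from-v i j + to-v i j) ⟩
        edges (S ∖ v) + ∑ (λ i → ∑ (λ j → from-v i j + to-v i j))
      ≡⟨ cong (edges (S ∖ v) +_) (∑²-distrib-+ from-v to-v) ⟩
        edges (S ∖ v) + (∑ (λ i → ∑ (from-v i)) + ∑ (λ i → ∑ (to-v i)))
      ≡⟨ cong (edges (S ∖ v) +_) (cong₂ _+_
           (trans (∑-comm from-v) (sum-cong-≗ λ j → ∑-δ v (λ i → ⟦ adj G i j ∧ S j ∧ before i j ⟧)))
           (sum-cong-≗ λ i → ∑-δ v (λ j → ⟦ adj G i j ∧ S i ∧ before i j ⟧))) ⟩
        edges (S ∖ v) + (∑ (λ j → ⟦ adj G v j ∧ S j ∧ before v j ⟧) + ∑ (λ i → ⟦ adj G i v ∧ S i ∧ before i v ⟧))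
      ≡⟨ cong (edges (S ∖ v) +_) (degreeIn-by-orientation S v) ⟨
        edges (S ∖ v) + degreeIn S v
      ∎
      where
      open ≡-Reasoning
      inside from-v to-v : Fin n → Fin n → ℕ
      inside i j = ⟦ adj G i j ∧ (S ∖ v) i ∧ (S ∖ v) j ∧ before i j ⟧
      from-v i j = if does (i ≟ v) then ⟦ adj G i j ∧ S j ∧ before i j ⟧ else 0
      to-v   i j = if does (j ≟ v) then ⟦ adj G i j ∧ S i ∧ before i j ⟧ else 0

    edges-empty : ∀ {S} → (∀ j → S j ≡ false) → edges S ≡ 0
    edges-empty {S} S≡∅ = ∑-zero λ i → ∑-zero λ j →
      trans (cong (λ b → ⟦ adj G i j ∧ b ∧ S j ∧ before i j ⟧) (S≡∅ i)) (cong ⟦_⟧ (∧-zeroʳ (adj G i j)))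

    degreeIn≤∣∖∣ : ∀ S v → degreeIn S v ≤ ∣ S ∖ v ∣
    degreeIn≤∣∖∣ S v = ∣∣-mono λ j v~j∧Sj →
      let v~j , Sj = ∧-true⁻ (adj G v j) v~j∧Sj in ∖⁺ {p = S} Sj (λ j≡v → Adj⇒≢ v~j (sym j≡v))

    ∑-degree-over-cover : ∀ R → IsVertexCover R →
      ∑ (λ i → if R i then ∣ adj G i ∣ else 0) ≡ edges (λ _ → true) + edges R
    ∑-degree-over-cover R cover = begin
        ∑ (λ i → if R i then ∣ adj G i ∣ else 0)
      ≡⟨ sum-cong-≗ restrict ⟩
        ∑ (λ i → ∑ (λ j → ⟦ adj G i j ∧ R i ⟧))
      ≡⟨ sum-cong-≗ (λ i → sum-cong-≗ (λ j → split-by-orientation i j (R i))) ⟩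
        ∑ (λ i → ∑ (λ j → forward i j + backward i j))
      ≡⟨ ∑²-distrib-+ forward backward ⟩
        ∑ (λ i → ∑ (forward i)) + ∑ (λ i → ∑ (backward i))
      ≡⟨ cong (∑ (λ i → ∑ (forward i)) +_) (trans (∑-comm backward)
           (sum-cong-≗ λ i → sum-cong-≗ λ j → cong (λ a → ⟦ a ∧ R j ∧ before i j ⟧) (adj-sym G j i))) ⟩
        ∑ (λ i → ∑ (forward i)) + ∑ (λ i → ∑ (reversed i))
      ≡⟨ ∑²-distrib-+ forward reversed ⟨
        ∑ (λ i → ∑ (λ j → forward i j + reversed i j))
      ≡⟨ sum-cong-≗ (λ i → sum-cong-≗ (covered i)) ⟩
        ∑ (λ i → ∑ (λ j → ⟦ adj G i j ∧ before i j ⟧ + ⟦ adj G i j ∧ R i ∧ R j ∧ before i j ⟧))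
      ≡⟨ ∑²-distrib-+ (λ i j → ⟦ adj G i j ∧ before i j ⟧) (λ i j → ⟦ adj G i j ∧ R i ∧ R j ∧ before i j ⟧) ⟩
        edges (λ _ → true) + edges R
      ∎
      where
      open ≡-Reasoning
      forward backward reversed : Fin n → Fin n → ℕ
      forward  i j = ⟦ adj G i j ∧ R i ∧ before i j ⟧
      backward i j = ⟦ adj G i j ∧ R i ∧ before j i ⟧
      reversed i j = ⟦ adj G i j ∧ R j ∧ before i j ⟧
      restrict : ∀ i → (if R i then ∣ adj G i ∣ else 0) ≡ ∑ (λ j → ⟦ adj G i j ∧ R i ⟧)
      restrict i with R i
      ... | true  = sum-cong-≗ (λ j → cong ⟦_⟧ (sym (∧-identityʳ (adj G i j))))
      ... | false = sym (∑-zero (λ j → cong ⟦_⟧ (∧-zeroʳ (adj G i j))))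
      covered : ∀ i j → forward i j + reversed i j ≡
                        ⟦ adj G i j ∧ before i j ⟧ + ⟦ adj G i j ∧ R i ∧ R j ∧ before i j ⟧
      covered i j with adj G i j in i~j | R i in Ri | R j in Rj
      ... | false | _     | _     = refl
      ... | true  | true  | _     = refl
      ... | true  | false | true  = sym (+-identityʳ _)
      ... | true  | false | false = ⊥-elim (cover i j Ri Rj i~j)

    walk-start : ∀ {S a b} → WalkIn G S a b → S a ≡ true
    walk-start (here Sa)     = Sa
    walk-start (step Sa _ _) = Sa

    walk-weaken : ∀ {S T} → (∀ x → S x ≡ true → T x ≡ true) → ∀ {a b} → WalkIn G S a b → WalkIn G T a b
    walk-weaken S⊆T (here Sa)       = here (S⊆T _ Sa)
    walk-weaken S⊆T (step Sa a~j w) = step (S⊆T _ Sa) a~j (walk-weaken S⊆T w)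

    walk-∖⁻ : ∀ {S v a b} → WalkIn G (S ∖ v) a b → WalkIn G S a b
    walk-∖⁻ {S} = walk-weaken (λ _ → ∖⁻ {p = S})

    _++ʷ_ : ∀ {S a b c} → WalkIn G S a b → WalkIn G S b c → WalkIn G S a c
    here _        ++ʷ w′ = w′
    step Sa a~j w ++ʷ w′ = step Sa a~j (w ++ʷ w′)

    chord⇒cycle : ∀ {x y ys c} → Unique (x ∷ y ∷ ys) → Linked (Adj G) (x ∷ y ∷ ys) →
                  c ∈ ys → Adj G x c → HasCycle G
    chord⇒cycle {x} {y} {ys} {c} unique linked c∈ys x~c with zs , rest , refl ← ∈-∃++ c∈ys =
      x , c , y ∷ zs ,
      Unique-++⁻ˡ (x ∷ y ∷ zs ∷ʳ c) (subst Unique split unique) ,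
      Linked-++⁻ˡ (x ∷ y ∷ zs ∷ʳ c) (subst (Linked (Adj G)) split linked) ,
      s≤s z≤n , trans (adj-sym G c x) x~c
      where
      split : x ∷ y ∷ zs ++ c ∷ rest ≡ (x ∷ y ∷ zs ∷ʳ c) ++ rest
      split = cong (λ l → x ∷ y ∷ l) (sym (++-assoc zs [ c ] rest))

    path-neighbour : ¬ HasCycle G → ∀ {x xs j} → Unique (x ∷ xs) → Linked (Adj G) (x ∷ xs) →
                     Adj G x j → j ∈ x ∷ xs → j ∈ take 1 xs
    path-neighbour _ _ _ x~x (here refl) = ⊥-elim (Adj⇒≢ x~x refl)
    path-neighbour _ {xs = y ∷ ys} _ _ _ (there (here j≡y)) = here j≡y
    path-neighbour acyclic {xs = y ∷ ys} unique linked x~j (there (there j∈ys)) =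
      ⊥-elim (acyclic (chord⇒cycle unique linked j∈ys x~j))

    -- An isolated vertex of S also counts as a leaf.
    LeafIn : (Fin n → Bool) → Fin n → Set
    LeafIn S v = S v ≡ true × degreeIn S v ≤ 1

    open DecMembership (_≟_ {n}) using (_∈?_)

    -- The fuel suffices because a simple path
    -- in S has at most ∣ S ∣ vertices; once x has no neighbour in S off the path, acyclicity
    -- leaves its predecessor as its only neighbour in S.
    extend-path : ¬ HasCycle G → ∀ {S} fuel x xs → Unique (x ∷ xs) → Linked (Adj G) (x ∷ xs) →
                  All (λ y → S y ≡ true) (x ∷ xs) → ∣ S ∣ ≤ fuel + length xs → ∃ (LeafIn S)
    extend-path _ zero x xs unique _ inS bound = ⊥-elim (1+n≰n (≤-trans (length≤∣∣ unique inS) bound))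
    extend-path acyclic {S} (suc fuel) x xs unique linked inS@(Sx ∷ _) bound
      with any? (λ j → (adj G x j Bool.≟ true) ×-dec (S j Bool.≟ true) ×-dec ¬? (j ∈? x ∷ xs))
    ... | yes (j , x~j , Sj , j∉path) =
      extend-path acyclic fuel j (x ∷ xs) (¬Any⇒All¬ _ j∉path ∷ unique) (trans (adj-sym G j x) x~j ∷ linked)
        (Sj ∷ inS) (subst (∣ S ∣ ≤_) (sym (+-suc fuel (length xs))) bound)
    ... | no stuck =
      x , Sx , ≤-trans (∣∣≤length (take 1 xs) neighbour-on-path)
                       (subst (_≤ 1) (sym (length-take 1 xs)) (m⊓n≤m 1 _))
      where
      neighbour-on-path : ∀ j → adj G x j ∧ S j ≡ true → j ∈ take 1 xs
      neighbour-on-path j x~j∧Sj with x~j , Sj ← ∧-true⁻ (adj G x j) x~j∧Sj =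
        path-neighbour acyclic unique linked x~j
          (decidable-stable (j ∈? x ∷ xs) (λ j∉path → stuck (j , x~j , Sj , j∉path)))

    acyclic⇒∃leaf : ¬ HasCycle G → ∀ {S} → 1 ≤ ∣ S ∣ → ∃ (LeafIn S)
    acyclic⇒∃leaf acyclic {S} ∣S∣>0 with v , Sv ← ∣∣>0⇒∃ S ∣S∣>0 =
      extend-path acyclic ∣ S ∣ v [] ([] ∷ []) [-] (Sv ∷ []) (≤-reflexive (sym (+-identityʳ ∣ S ∣)))

    attach-leaf : ∀ {S v u} → S v ≡ true → Adj G v u → (S ∖ v) u ≡ true →
                  ConnectedOn G (S ∖ v) → ConnectedOn G S
    attach-leaf {S} {v} {u} Sv v~u S∖v∋u connected i j Si Sj with i ≟ v | j ≟ v
    ... | yes refl | yes refl = here Si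
    ... | yes refl | no j≢v   = step Si v~u (walk-∖⁻ (connected u j S∖v∋u (∖⁺ {p = S} Sj j≢v)))
    ... | no i≢v   | yes refl =
      walk-∖⁻ (connected i u (∖⁺ {p = S} Si i≢v) S∖v∋u) ++ʷ
      step (∖⁻ {p = S} S∖v∋u) (trans (adj-sym G u v) v~u) (here Sj)
    ... | no i≢v   | no j≢v   = walk-∖⁻ (connected i j (∖⁺ {p = S} Si i≢v) (∖⁺ {p = S} Sj j≢v))

    -- A walk entering v must leave it towards the vertex it came from, so the detour is cut out.
    bypass : ∀ {S v} → (∀ {a b} → Adj G v a → S a ≡ true → Adj G v b → S b ≡ true → a ≡ b) →
             ∀ {a b} → WalkIn G S a b → a ≢ v → b ≢ v → WalkIn G (S ∖ v) a b
    bypass {S} unique (here Sa) a≢v _ = here (∖⁺ {p = S} Sa a≢v)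
    bypass {S} {v} unique {a} (step {j = j} Sa a~j w) a≢v b≢v with j ≟ v
    ... | no j≢v = step (∖⁺ {p = S} Sa a≢v) a~j (bypass unique w j≢v b≢v)
    ... | yes refl with w
    ...   | here _ = ⊥-elim (b≢v refl)
    ...   | step _ v~k w′ rewrite unique (trans (adj-sym G v a) a~j) Sa v~k (walk-start w′) =
            bypass unique w′ a≢v b≢v

    remove-leaf : ∀ {S v} → degreeIn S v ≤ 1 → ConnectedOn G S → ConnectedOn G (S ∖ v)
    remove-leaf {S} {v} deg≤1 connected i j S∖v∋i S∖v∋j =
      bypass unique (connected i j (∖⁻ {p = S} S∖v∋i) (∖⁻ {p = S} S∖v∋j))
                    (∖-≢ {p = S} S∖v∋i) (∖-≢ {p = S} S∖v∋j)
      where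
      unique : ∀ {a b} → Adj G v a → S a ≡ true → Adj G v b → S b ≡ true → a ≡ b
      unique v~a Sa v~b Sb =
        ∣∣≤1⇒unique {p = λ j → adj G v j ∧ S j} deg≤1 (cong₂ _∧_ v~a Sa) (cong₂ _∧_ v~b Sb)

    connected⇒degreeIn>0 : ∀ {S v w} → ConnectedOn G S → S v ≡ true → (S ∖ v) w ≡ true → 1 ≤ degreeIn S v
    connected⇒degreeIn>0 {S} {v} {w} connected Sv S∖v∋w with connected v w Sv (∖⁻ {p = S} S∖v∋w)
    ... | here _        = ⊥-elim (∖-≢ {p = S} S∖v∋w refl)
    ... | step _ v~j w′ = ∣∣>0 {p = λ j → adj G v j ∧ S j} (cong₂ _∧_ v~j (walk-start w′))

    connected-∖leaf : ∀ {S v} → LeafIn S v → 1 ≤ ∣ S ∖ v ∣ →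
                      ConnectedOn G S ⇔ (degreeIn S v ≡ 1 × ConnectedOn G (S ∖ v))
    connected-∖leaf {S} {v} (Sv , deg≤1) ∣S∖v∣>0 = mk⇔
      (λ connected → let w , S∖v∋w = ∣∣>0⇒∃ (S ∖ v) ∣S∖v∣>0 in
        ≤-antisym deg≤1 (connected⇒degreeIn>0 connected Sv S∖v∋w) , remove-leaf deg≤1 connected)
      (λ (deg≡1 , connected) →
        let u , v~u∧Su = ∣∣>0⇒∃ _ (≤-reflexive (sym deg≡1))
            v~u , Su   = ∧-true⁻ (adj G v u) v~u∧Su
        in attach-leaf Sv v~u (∖⁺ {p = S} Su (λ u≡v → Adj⇒≢ v~u (sym u≡v))) connected)

    ForestBound : (Fin n → Bool) → Set
    ForestBound S = suc (edges S) ≤ ∣ S ∣ × (suc (edges S) ≡ ∣ S ∣ ⇔ ConnectedOn G S)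

    forest-bound-by-size : ¬ HasCycle G → ∀ k {S} → ∣ S ∣ ≡ suc k → ForestBound S
    forest-bound-by-size acyclic zero {S} ∣S∣≡1 with v , Sv ← ∣∣>0⇒∃ S (≤-reflexive (sym ∣S∣≡1)) =
      ≤-reflexive single-vertex , mk⇔ (λ _ → connected) (λ _ → single-vertex)
      where
      ∣S∖v∣≡0 : ∣ S ∖ v ∣ ≡ 0
      ∣S∖v∣≡0 = suc-injective (trans (sym (∣∣-∖ {p = S} Sv)) ∣S∣≡1)
      single-vertex : suc (edges S) ≡ ∣ S ∣
      single-vertex = begin
        suc (edges S)                       ≡⟨ cong suc (edges-∖ Sv) ⟩
        suc (edges (S ∖ v) + degreeIn S v)  ≡⟨ cong₂ (λ e d → suc (e + d))
                                                 (edges-empty (∣∣≡0⇒∅ (S ∖ v) ∣S∖v∣≡0))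
                                                 (n≤0⇒n≡0 (subst (degreeIn S v ≤_) ∣S∖v∣≡0 (degreeIn≤∣∖∣ S v))) ⟩
        1                                   ≡⟨ ∣S∣≡1 ⟨
        ∣ S ∣                               ∎
        where open ≡-Reasoning
      connected : ConnectedOn G S
      connected i j Si Sj
        rewrite ∣∣≤1⇒unique {p = S} (≤-reflexive ∣S∣≡1) Si Sv
            | ∣∣≤1⇒unique {p = S} (≤-reflexive ∣S∣≡1) Sj Sv = here Sv
    forest-bound-by-size acyclic (suc k) {S} ∣S∣≡2+k
      with v , leaf@(Sv , deg≤1) ← acyclic⇒∃leaf acyclic (subst (1 ≤_) (sym ∣S∣≡2+k) (s≤s z≤n)) =
      let bound , count⇔ = leaf-count-arithmetic (edges-∖ Sv) (∣∣-∖ {p = S} Sv) deg≤1 (proj₁ ih)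
      in bound , ⇔-trans count⇔ (⇔-trans (⇔-refl ×-⇔ proj₂ ih) (⇔-sym (connected-∖leaf leaf ∣S∖v∣>0)))
      where
      ∣S∖v∣≡1+k : ∣ S ∖ v ∣ ≡ suc k
      ∣S∖v∣≡1+k = suc-injective (trans (sym (∣∣-∖ {p = S} Sv)) ∣S∣≡2+k)
      ∣S∖v∣>0 : 1 ≤ ∣ S ∖ v ∣
      ∣S∖v∣>0 = subst (1 ≤_) (sym ∣S∖v∣≡1+k) (s≤s z≤n)
      ih : ForestBound (S ∖ v)
      ih = forest-bound-by-size acyclic k ∣S∖v∣≡1+k

    acyclic⇒forest-bound : ¬ HasCycle G → ∀ {S v} → S v ≡ true → ForestBound S
    acyclic⇒forest-bound acyclic {S} Sv = forest-bound-by-size acyclic _ (∣∣-∖ {p = S} Sv)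

    count≡∣∣ : ∀ p → count G p ≡ ∣ p ∣
    count≡∣∣ p = sum-map-tabulate (λ i → if p i then 1 else 0) id

    edgesIn≡edges : ∀ S → edgesIn G S ≡ edges S
    edgesIn≡edges S = trans (sum-map-tabulate (λ i → count G (λ j → adj G i j ∧ S i ∧ S j ∧ before i j)) id)
                            (sum-cong-≗ λ i → count≡∣∣ (λ j → adj G i j ∧ S i ∧ S j ∧ before i j))

    acyclic⇒edgesIn<count : ¬ HasCycle G → ∀ {S v} → S v ≡ true →
      suc (edgesIn G S) ≤ count G S × (suc (edgesIn G S) ≡ count G S ⇔ ConnectedOn G S)
    acyclic⇒edgesIn<count acyclic {S} Sv =
      subst₂ (λ e c → suc e ≤ c × (suc e ≡ c ⇔ ConnectedOn G S)) (sym (edgesIn≡edges S)) (sym (count≡∣∣ S))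
        (acyclic⇒forest-bound acyclic Sv)

    tree-order : IsTree G → n ≡ suc (edgesIn G (λ _ → true))
    tree-order (v , connected , acyclic) = begin
        n
      ≡⟨ ∣full∣≡n ⟨
        ∣ (λ (_ : Fin n) → true) ∣
      ≡⟨ count≡∣∣ (λ _ → true) ⟨
        count G (λ _ → true)
      ≡⟨ Equivalence.from (proj₂ (acyclic⇒edgesIn<count acyclic {v = v} refl)) connected ⟨
        suc (edgesIn G (λ _ → true))
      ∎
      where open ≡-Reasoning

    count+count-not : ∀ R → count G R + count G (not ∘ R) ≡ n
    count+count-not R = trans (cong₂ _+_ (count≡∣∣ R) (count≡∣∣ (not ∘ R))) (∣∣+∣not∣≡n R)

    degree-sum-over-cover : ∀ R → IsVertexCover R →
      sum (map (λ x → if R x then degree G x else 0) (allFin n)) ≡ edgesIn G (λ _ → true) + edgesIn G R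
    degree-sum-over-cover R cover = begin
        sum (map (λ x → if R x then degree G x else 0) (allFin n))
      ≡⟨ sum-map-tabulate (λ x → if R x then degree G x else 0) id ⟩
        ∑ (λ x → if R x then degree G x else 0)
      ≡⟨ sum-cong-≗ (λ x → cong (λ d → if R x then d else 0) (count≡∣∣ (adj G x))) ⟩
        ∑ (λ x → if R x then ∣ adj G x ∣ else 0)
      ≡⟨ ∑-degree-over-cover R cover ⟩
        edges (λ _ → true) + edges R
      ≡⟨ cong₂ _+_ (edgesIn≡edges (λ _ → true)) (edgesIn≡edges R) ⟨
        edgesIn G (λ _ → true) + edgesIn G R
      ∎
      where open ≡-Reasoning

open Forests using (tree-order; count+count-not; acyclic⇒edgesIn<count; degree-sum-over-cover)

open import Defs
open import Data.Nat using (ℕ)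
open import Data.Bool using (not)
open import Data.Integer using (ℤ; +_; _+_; _-_; _≤_)
open import Data.Product using (_×_)
open import Relation.Binary.PropositionalEquality using (_≡_)
open import Function.Bundles using (_⇔_)

open import Data.Bool using (Bool; true; false; if_then_else_)
open import Data.Fin using (Fin)
open import Data.Integer.Properties using (+-identityˡ; +-identityʳ; +-injective; i≤i+j; +-0-abelianGroup)
open import Algebra.Bundles using (AbelianGroup)
open import Algebra.Properties.Group (AbelianGroup.group +-0-abelianGroup) using (∙-cancelˡ)
open import Data.Integer.Tactic.RingSolver using (solve-∀)
open import Data.List using (List; []; _∷_; foldr; map; allFin)
open import Data.List.Properties using (foldr-universal)
import Data.Nat as ℕ
import Data.Nat.Properties as ℕ
open import Data.Nat.ListAction using (sum)
open import Data.Product using (_,_)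
open import Function.Bundles using (mk⇔)
open import Function.Properties.Equivalence using () renaming (trans to ⇔-trans)
open import Relation.Binary.PropositionalEquality using (refl)
import Relation.Binary.PropositionalEquality as ≡

-- The local function defining sumOver cannot be named; abstracting allFin n lets
-- foldr-universal identify it.
sumOver≡foldr : ∀ {n} (G : Graph n) S (f : Fin n → ℤ) →
                sumOver G S f ≡ foldr (λ x acc → (if S x then f x else + 0) + acc) (+ 0) (allFin n)
sumOver≡foldr {n} G S f
  with allFin n | foldr-universal _ (λ x acc → (if S x then f x else + 0) + acc) (+ 0) refl (λ _ _ → refl)
... | xs | universal = universal xs

foldr-minus-one : ∀ {n} (S : Fin n → Bool) (d : Fin n → ℕ) (xs : List (Fin n)) →
  foldr (λ x acc → (if S x then + d x - + 1 else + 0) + acc) (+ 0) xs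
    ≡ + sum (map (λ x → if S x then d x else 0) xs) - + sum (map (λ x → if S x then 1 else 0) xs)
foldr-minus-one S d [] = refl
foldr-minus-one S d (x ∷ xs) with S x
... | true  = ≡.trans (≡.cong (_+_ (+ d x - + 1)) (foldr-minus-one S d xs))
                      (regroup (+ d x) (+ sum (map (λ x → if S x then d x else 0) xs))
                                       (+ sum (map (λ x → if S x then 1 else 0) xs)))
  where
  regroup : ∀ D A B → (D - + 1) + (A - B) ≡ (D + A) - (+ 1 + B)
  regroup = solve-∀
... | false = ≡.trans (+-identityˡ _) (foldr-minus-one S d xs)

sumOver-minus-one : ∀ {n} (G : Graph n) S (d : Fin n → ℕ) →
  sumOver G S (λ x → + d x - + 1) ≡ + sum (map (λ x → if S x then d x else 0) (allFin n)) - + count G S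
sumOver-minus-one {n} G S d =
  ≡.trans (sumOver≡foldr G S (λ x → + d x - + 1)) (foldr-minus-one S d (allFin n))

≤-by : ∀ {x y : ℤ} (k : ℕ) → x + + k ≡ y → x ≤ y
≤-by {x} k x+k≡y = ≡.subst (x ≤_) x+k≡y (i≤i+j x (+ k))

+k≡⇒[≡⇔k≡0] : ∀ {x y : ℤ} {k : ℕ} → x + + k ≡ y → (x ≡ y ⇔ k ≡ 0)
+k≡⇒[≡⇔k≡0] {x} refl = mk⇔
  (λ x≡x+k → +-injective (∙-cancelˡ x _ _ (≡.trans (≡.sym x≡x+k) (≡.sym (+-identityʳ x)))))
  (λ { refl → ≡.sym (+-identityʳ x) })

k≡0⇔m≡m+k : ∀ {m k : ℕ} → k ≡ 0 ⇔ m ≡ m ℕ.+ k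
k≡0⇔m≡m+k {m} {k} = mk⇔
  (λ { refl → ≡.sym (ℕ.+-identityʳ m) })
  (λ m≡m+k → ℕ.+-cancelˡ-≡ m k 0 (≡.trans (≡.sym m≡m+k) (≡.sym (ℕ.+-identityʳ m))))

-- Writing r = 1 + a + k, the hypotheses force n = r + m and e = a + k + m, so τ = e + a - r and
-- each claim becomes a ring identity in a, k, m (k ≥ 0 measures how far χ = r - a exceeds 1).
-- Since + x + + y reduces to + (x ℕ.+ y), the identities instantiated at + a, + k, + m match the
-- goals definitionally.
stem-arithmetic : ∀ {n m r a e : ℕ} {τ : ℤ} {P : Set} →
  n ≡ ℕ.suc e → r ℕ.+ m ≡ n → τ ≡ + (e ℕ.+ a) - + r → a ℕ.< r → (ℕ.suc a ≡ r ⇔ P) →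
  (τ + + 2 - + r ≤ + m) × (+ m ≤ τ + + 1) × (τ ≡ + n - + 1 - (+ r - + a)) × (τ ≤ + n - + 2) × ((τ ≡ + n - + 2) ⇔ P)
stem-arithmetic {m = m} {a = a} n≡1+e r+m≡n refl a<r a<r⇔P
  with k , refl ← ℕ.m≤n⇒∃[o]m+o≡n a<r | refl ← r+m≡n | refl ← n≡1+e =
  ≤-by k (lower (+ a) (+ k) (+ m)) ,
  ≤-by a (upper (+ a) (+ k) (+ m)) ,
  euler (+ a) (+ k) (+ m) ,
  ≤-by k (top (+ a) (+ k) (+ m)) ,
  ⇔-trans (+k≡⇒[≡⇔k≡0] (top (+ a) (+ k) (+ m))) (⇔-trans k≡0⇔m≡m+k a<r⇔P)
  where
  lower : ∀ A K M → (((A + K + M) + A - (+ 1 + A + K)) + + 2 - (+ 1 + A + K)) + K ≡ M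
  lower = solve-∀
  upper : ∀ A K M → M + A ≡ ((A + K + M) + A - (+ 1 + A + K)) + + 1
  upper = solve-∀
  euler : ∀ A K M → (A + K + M) + A - (+ 1 + A + K) ≡ (+ 1 + A + K + M) - + 1 - ((+ 1 + A + K) - A)
  euler = solve-∀
  top : ∀ A K M → ((A + K + M) + A - (+ 1 + A + K)) + K ≡ (+ 1 + A + K + M) - + 2
  top = solve-∀

corollary7p8 : ∀ {n : ℕ} (D : StemDiagram n) → NonTrivial D →
    let G = graph D
        r = count G (red D)
        m = count G (λ x → not (red D x))
    in (τ* D + + 2 - + r ≤ + m)
       × (+ m ≤ τ* D + + 1)
       × (τ* D ≡ + n - + 1 - χ G (red D))
       × (τ* D ≤ + n - + 2)
       × ((τ* D ≡ + n - + 2) ⇔ ConnectedOn G (red D))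
corollary7p8 {n} D (_ , x-red) =
  let _ , _ , acyclic = tree D
      e[R]<r , e[R]+1≡r⇔connected = acyclic⇒edgesIn<count G acyclic x-red
  in stem-arithmetic (tree-order G (tree D)) (count+count-not G R) τ*≡ e[R]<r e[R]+1≡r⇔connected
  where
  G : Graph n
  G = graph D
  R : Fin n → Bool
  R = red D
  τ*≡ : τ* D ≡ + (edgesIn G (λ _ → true) ℕ.+ edgesIn G R) - + count G R
  τ*≡ = ≡.trans (sumOver-minus-one G R (degree G))
                (≡.cong (λ s → + s - + count G R) (degree-sum-over-cover G R (noBlueEdge D)))
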